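{- Let $n\ge 7$ and let $\mathcal{F}$ be an independent set of $\Gamma(n,1,n-3)$ containing flags $(A_1,B_1),(A_2,B_2)$ with $A_1=A_2$, $B_1\neq B_2$ and $|[n]\setminus(B_1\cup B_2)|=2$. If $A\subseteq[n]\setminus(B_1\cup B_2)$ with $|A|=1$, then the $\mathcal{F}$-weight of $A$ is at most $\binom{n-1}{3}-(n-5)(n-4)+\binom{n-5}{2}$.
   Context: $[n]=\{1,\dots,n\}$. The graph $\Gamma(n,1,n-3)$ has as vertices the pairs (flags) $(A,B)$ with $A\subseteq B\subseteq[n]$, $|A|=1$, $|B|=n-3$; two vertices $(A_1,B_1),(A_2,B_2)$ are adjacent (opposite) iff $B_1\cup B_2=[n]$, $A_1\cap B_2=\emptyset$ and $A_2\cap B_1=\emptyset$. An independent set is a set of pairwise non-adjacent vertices. For an independent set $\mathcal{F}$ and a $1$-subset $A\subseteq[n]$, the $\mathcal{F}$-weight of $A$ is the number of flags in $\mathcal{F}$ whose first component is $A$. -}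

module Defs where

open import Data.Nat using (ℕ; _∸_)
open import Data.Bool using (Bool)
open import Data.Bool.Properties using () renaming (_≟_ to _≟ᵇ_)
open import Data.Fin.Subset using (Subset; ⊤; ⊥; _∪_; _∩_; _⊆_; ∣_∣)
open import Data.Vec.Properties using (≡-dec)
open import Data.Product using (_×_; _,_; proj₁; proj₂)
open import Data.List using (List; filter; length)
open import Data.List.Membership.Propositional using (_∈_)
open import Data.List.Relation.Unary.Unique.Propositional using (Unique)
open import Relation.Binary.PropositionalEquality using (_≡_)
open import Relation.Binary.Definitions using (DecidableEquality)
open import Relation.Nullary using (¬_)

-- Subsets of [n] are Data.Fin.Subset (Fin n = {0,…,n-1} stands for [n]).
_≟ˢ_ : ∀ {n} → DecidableEquality (Subset n)
_≟ˢ_ = ≡-dec _≟ᵇ_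

Pair : ℕ → Set
Pair n = Subset n × Subset n

IsFlag : ∀ {n} → Pair n → Set
IsFlag {n} (A , B) = (A ⊆ B) × (∣ A ∣ ≡ 1) × (∣ B ∣ ≡ n ∸ 3)

Opposite : ∀ {n} → Pair n → Pair n → Set
Opposite (A₁ , B₁) (A₂ , B₂) =
  (B₁ ∪ B₂ ≡ ⊤) × (A₁ ∩ B₂ ≡ ⊥) × (A₂ ∩ B₁ ≡ ⊥)

IsIndependentSet : ∀ {n} → List (Pair n) → Set
IsIndependentSet {n} F =
  Unique F
  × (∀ {f} → f ∈ F → IsFlag f)
  × (∀ {f g} → f ∈ F → g ∈ F → ¬ Opposite f g)

weight : ∀ {n} → List (Pair n) → Subset n → ℕ
weight F A = length (filter (λ f → proj₁ f ≟ˢ A) F)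

-- Write A = {x}, A₁ = A₂ = {a} and ∁ (B₁ ∪ B₂) = {x, y}; then ∁ Bᵢ = {x, y, zᵢ} with z₁ ≠ z₂.
-- A flag ({x}, B) of F is determined by the 3-set T = ∁ B, which avoids x. If a ∉ T there are
-- C(n-2, 3) choices for T. If a ∈ T, then ({x}, B) is opposite to ({a}, Bᵢ) unless T meets
-- {y, zᵢ}; so either y ∈ T, leaving n - 3 choices, or T = {a, z₁, z₂}. The weight of {x} is
-- therefore at most C(n-2, 3) + (n - 3) + 1, which is exactly the stated bound.
module Submission where

open import Defs
open import Data.Nat using (ℕ; zero; suc; pred; _≤_; _∸_; _*_; _+_; z≤n; s≤s)
open import Data.Nat.Properties
  using (module ≤-Reasoning; ≤-reflexive; ≤-trans; +-monoˡ-≤; +-cancelʳ-≤; +-comm; m≤n+m∸n; m+n∸n≡m; suc-injective; m≤n⇒∃[o]m+o≡n)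
open import Data.Nat.Combinatorics using (_C_; nCk+nC[k+1]≡[n+1]C[k+1]; nC1≡n)
open import Data.Nat.Tactic.RingSolver using (solve-∀)
open import Data.Fin using (Fin; zero; suc; _≟_)
open import Data.Fin.Subset
  using (Subset; inside; outside; ⊤; ⊥; ⁅_⁆; _∪_; _∩_; _─_; _-_; ∁; ∣_∣; _⊆_)
  renaming (_∈_ to _∈ₛ_; _∉_ to _∉ₛ_)
open import Data.Fin.Subset.Properties
  using ( _∈?_; ⊥⊆; ⊆⊤; ⊆-antisym; ⊆-reflexive; x∈⁅x⁆; x∈⁅y⁆⇒x≡y; x≢y⇒x∉⁅y⁆; x∉⁅y⁆⇒x≢y; ∣⁅x⁆∣≡1
        ; x∈p⇒x∉∁p; x∈∁p⇒x∉p; x∉∁p⇒x∈p; x∉p⇒x∈∁p; ∁p⊆∁q⇒p⊇q; ∣∁p∣≡n∸∣p∣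
        ; x∈p∪q⁺; x∈p∪q⁻; x∈p∩q⁻; Empty-unique; drop-∷-⊆
        ; p─⊥≡p; p─q─r≡p─q∪r; p─q⊆p; x∈p∧x≢y⇒x∈p-y)
open import Data.Vec using ([]; _∷_; here; there)
open import Data.List using (List; []; _∷_; [_]; _++_; map; filter; length)
open import Data.List.Properties using (length-map; length-++; length-++-sucʳ)
open import Data.List.Membership.Propositional using (_∈_)
open import Data.List.Membership.Propositional.Properties
  using (∈-map⁺; ∈-map⁻; ∈-++⁺ˡ; ∈-++⁺ʳ; ∈-++⁻; ∈-filter⁻; ∈-∃++)
open import Data.List.Relation.Unary.Any using (here; there)
import Data.List.Relation.Unary.All as All
import Data.List.Relation.Unary.All.Properties as All
open import Data.List.Relation.Unary.AllPairs using ([]; _∷_)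
open import Data.List.Relation.Unary.Unique.Propositional using (Unique)
open import Data.List.Relation.Unary.Unique.Propositional.Properties using (filter⁺)
open import Data.Product using (∃; _,_; proj₁; proj₂)
open import Data.Sum using (_⊎_; inj₁; inj₂)
open import Data.Empty using (⊥-elim)
open import Function using (_∘_)
open import Relation.Binary.PropositionalEquality hiding ([_])
open import Relation.Nullary using (¬_; Dec; yes; no)

Unique∧⊆⇒length≤ : ∀ {A : Set} {xs ys : List A} →
  Unique xs → (∀ {z} → z ∈ xs → z ∈ ys) → length xs ≤ length ys
Unique∧⊆⇒length≤ {xs = []} _ _ = z≤n
Unique∧⊆⇒length≤ {xs = x ∷ xs} (x∉xs ∷ xs-unique) xs⊆ys with ∈-∃++ (xs⊆ys (here refl))
... | ys₁ , ys₂ , refl =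
  subst (suc (length xs) ≤_) (sym (length-++-sucʳ ys₁ x ys₂))
    (s≤s (Unique∧⊆⇒length≤ xs-unique xs⊆ys₁++ys₂))
  where
  xs⊆ys₁++ys₂ : ∀ {z} → z ∈ xs → z ∈ ys₁ ++ ys₂
  xs⊆ys₁++ys₂ z∈xs with ∈-++⁻ ys₁ (xs⊆ys (there z∈xs))
  ... | inj₁ z∈ys₁         = ∈-++⁺ˡ z∈ys₁
  ... | inj₂ (here refl)   = ⊥-elim (All.lookup x∉xs z∈xs refl)
  ... | inj₂ (there z∈ys₂) = ∈-++⁺ʳ ys₁ z∈ys₂

Unique-map⁺ : ∀ {A B : Set} (f : A → B) {xs : List A} →
  (∀ {u v} → u ∈ xs → v ∈ xs → f u ≡ f v → u ≡ v) → Unique xs → Unique (map f xs)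
Unique-map⁺ f {[]} _ [] = []
Unique-map⁺ f {x ∷ xs} f-injective (x∉xs ∷ xs-unique) =
  All.map⁺ (All.tabulate λ v∈xs fx≡fv → All.lookup x∉xs v∈xs (f-injective (here refl) (there v∈xs) fx≡fv))
  ∷ Unique-map⁺ f (λ u∈xs v∈xs → f-injective (there u∈xs) (there v∈xs)) xs-unique

∈∧∉⇒≢ : ∀ {n} {i j : Fin n} {p : Subset n} → i ∈ₛ p → j ∉ₛ p → i ≢ j
∈∧∉⇒≢ i∈p j∉p refl = j∉p i∈p

∁-injective : ∀ {n} {p q : Subset n} → ∁ p ≡ ∁ q → p ≡ q
∁-injective ∁p≡∁q = ⊆-antisym (∁p⊆∁q⇒p⊇q (⊆-reflexive (sym ∁p≡∁q))) (∁p⊆∁q⇒p⊇q (⊆-reflexive ∁p≡∁q))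

x∈p⇒⁅x⁆⊆p : ∀ {n} {x : Fin n} {p : Subset n} → x ∈ₛ p → ⁅ x ⁆ ⊆ p
x∈p⇒⁅x⁆⊆p {x = x} x∈p i∈⁅x⁆ = subst (_∈ₛ _) (sym (x∈⁅y⁆⇒x≡y x i∈⁅x⁆)) x∈p

p⊆r∧q⊆r⇒p∪q⊆r : ∀ {n} {p q r : Subset n} → p ⊆ r → q ⊆ r → p ∪ q ⊆ r
p⊆r∧q⊆r⇒p∪q⊆r {p = p} {q} p⊆r q⊆r i∈p∪q with x∈p∪q⁻ p q i∈p∪q
... | inj₁ i∈p = p⊆r i∈p
... | inj₂ i∈q = q⊆r i∈q

x∉p⇒⁅x⁆∩p≡⊥ : ∀ {n} {x : Fin n} {p : Subset n} → x ∉ₛ p → ⁅ x ⁆ ∩ p ≡ ⊥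
x∉p⇒⁅x⁆∩p≡⊥ {x = x} {p} x∉p = Empty-unique λ (i , i∈⁅x⁆∩p) →
  let i∈⁅x⁆ , i∈p = x∈p∩q⁻ ⁅ x ⁆ p i∈⁅x⁆∩p in
  x∉p (subst (_∈ₛ p) (x∈⁅y⁆⇒x≡y x i∈⁅x⁆) i∈p)

x∈p─q⇒x∉q : ∀ {n} {x : Fin n} (p q : Subset n) → x ∈ₛ p ─ q → x ∉ₛ q
x∈p─q⇒x∉q (_ ∷ p) (_ ∷ q) (there x∈p─q) (there x∈q) = x∈p─q⇒x∉q p q x∈p─q x∈q
x∈p─q⇒x∉q (_ ∷ p) (_ ∷ q) () here

∈⇒≡⊎∈- : ∀ {n} {i : Fin n} {p : Subset n} (x : Fin n) → i ∈ₛ p → i ≡ x ⊎ i ∈ₛ p - x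
∈⇒≡⊎∈- {i = i} x i∈p with i ≟ x
... | yes i≡x = inj₁ i≡x
... | no i≢x  = inj₂ (x∈p∧x≢y⇒x∈p-y i∈p i≢x)

∣p∣≡0⇒p≡⊥ : ∀ {n} (p : Subset n) → ∣ p ∣ ≡ 0 → p ≡ ⊥
∣p∣≡0⇒p≡⊥ []            _     = refl
∣p∣≡0⇒p≡⊥ (outside ∷ p) ∣p∣≡0 = cong (outside ∷_) (∣p∣≡0⇒p≡⊥ p ∣p∣≡0)

∣p∣≡1⇒p≡⁅x⁆ : ∀ {n} (p : Subset n) → ∣ p ∣ ≡ 1 → ∃ λ x → p ≡ ⁅ x ⁆
∣p∣≡1⇒p≡⁅x⁆ (inside ∷ p)  ∣p∣≡1 = zero , cong (inside ∷_) (∣p∣≡0⇒p≡⊥ p (suc-injective ∣p∣≡1))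
∣p∣≡1⇒p≡⁅x⁆ (outside ∷ p) ∣p∣≡1 with ∣p∣≡1⇒p≡⁅x⁆ p ∣p∣≡1
... | x , refl = suc x , refl

x∈p⇒∣p∣≡1+∣p-x∣ : ∀ {n} {x : Fin n} {p : Subset n} → x ∈ₛ p → ∣ p ∣ ≡ suc ∣ p - x ∣
x∈p⇒∣p∣≡1+∣p-x∣ {p = inside ∷ p}  here          = cong (suc ∘ ∣_∣) (sym (p─⊥≡p p))
x∈p⇒∣p∣≡1+∣p-x∣ {p = inside ∷ p}  (there x∈p) = cong suc (x∈p⇒∣p∣≡1+∣p-x∣ x∈p)
x∈p⇒∣p∣≡1+∣p-x∣ {p = outside ∷ p} (there x∈p) = x∈p⇒∣p∣≡1+∣p-x∣ x∈p

x∈p⇒∣p-x∣≡pred∣p∣ : ∀ {n k} {x : Fin n} {p : Subset n} → x ∈ₛ p → ∣ p ∣ ≡ k → ∣ p - x ∣ ≡ pred k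
x∈p⇒∣p-x∣≡pred∣p∣ x∈p ∣p∣≡k = cong pred (trans (sym (x∈p⇒∣p∣≡1+∣p-x∣ x∈p)) ∣p∣≡k)

-- The subsets T with L ⊆ T ⊆ U and ∣ T ─ L ∣ ≡ j. At points of L outside U the upper
-- bound is ignored, which makes the length formula unconditional.
between : ∀ {n} → Subset n → Subset n → ℕ → List (Subset n)
between []            []           zero    = [ [] ]
between []            []           (suc j) = []
between (inside ∷ L)  (_ ∷ U)      j       = map (inside ∷_) (between L U j)
between (outside ∷ L) (outside ∷ U) j      = map (outside ∷_) (between L U j)
between (outside ∷ L) (inside ∷ U) zero    = map (outside ∷_) (between L U zero)
between (outside ∷ L) (inside ∷ U) (suc j) =
  map (outside ∷_) (between L U (suc j)) ++ map (inside ∷_) (between L U j)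

length-between : ∀ {n} (L U : Subset n) j → length (between L U j) ≡ ∣ U ─ L ∣ C j
length-between []            []           zero    = refl
length-between []            []           (suc j) = refl
length-between (inside ∷ L)  (_ ∷ U)      j       = trans (length-map _ (between L U j)) (length-between L U j)
length-between (outside ∷ L) (outside ∷ U) j      = trans (length-map _ (between L U j)) (length-between L U j)
length-between (outside ∷ L) (inside ∷ U) zero    = trans (length-map _ (between L U 0)) (length-between L U 0)
length-between (outside ∷ L) (inside ∷ U) (suc j) = begin
  length (map (outside ∷_) (between L U (suc j)) ++ map (inside ∷_) (between L U j))
    ≡⟨ length-++ (map (outside ∷_) (between L U (suc j))) ⟩
  length (map (outside ∷_) (between L U (suc j))) + length (map (inside ∷_) (between L U j))
    ≡⟨ cong₂ _+_ (length-map _ (between L U (suc j))) (length-map _ (between L U j)) ⟩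
  length (between L U (suc j)) + length (between L U j)
    ≡⟨ cong₂ _+_ (length-between L U (suc j)) (length-between L U j) ⟩
  ∣ U ─ L ∣ C suc j + ∣ U ─ L ∣ C j
    ≡⟨ +-comm (∣ U ─ L ∣ C suc j) _ ⟩
  ∣ U ─ L ∣ C j + ∣ U ─ L ∣ C suc j
    ≡⟨ nCk+nC[k+1]≡[n+1]C[k+1] ∣ U ─ L ∣ j ⟩
  suc ∣ U ─ L ∣ C suc j
    ∎
  where open ≡-Reasoning

∈-between : ∀ {n} {L T U : Subset n} {j} → L ⊆ T → T ⊆ U → ∣ T ─ L ∣ ≡ j → T ∈ between L U j
∈-between {L = []} {[]} {[]} _ _ refl = here refl
∈-between {L = inside ∷ L} {T = t ∷ T} {_ ∷ U} L⊆T T⊆U ∣T─L∣≡j with L⊆T here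
... | here = ∈-map⁺ (inside ∷_) (∈-between (drop-∷-⊆ L⊆T) (drop-∷-⊆ T⊆U) ∣T─L∣≡j)
∈-between {L = outside ∷ L} {T = inside ∷ T} {u ∷ U} L⊆T T⊆U refl with T⊆U here
... | here = ∈-++⁺ʳ (map (outside ∷_) (between L U _))
               (∈-map⁺ (inside ∷_) (∈-between (drop-∷-⊆ L⊆T) (drop-∷-⊆ T⊆U) refl))
∈-between {L = outside ∷ L} {T = outside ∷ T} {outside ∷ U} L⊆T T⊆U ∣T─L∣≡j =
  ∈-map⁺ (outside ∷_) (∈-between (drop-∷-⊆ L⊆T) (drop-∷-⊆ T⊆U) ∣T─L∣≡j)
∈-between {L = outside ∷ L} {T = outside ∷ T} {inside ∷ U} {zero} L⊆T T⊆U ∣T─L∣≡0 =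
  ∈-map⁺ (outside ∷_) (∈-between (drop-∷-⊆ L⊆T) (drop-∷-⊆ T⊆U) ∣T─L∣≡0)
∈-between {L = outside ∷ L} {T = outside ∷ T} {inside ∷ U} {suc j} L⊆T T⊆U ∣T─L∣≡1+j =
  ∈-++⁺ˡ (∈-map⁺ (outside ∷_) (∈-between (drop-∷-⊆ L⊆T) (drop-∷-⊆ T⊆U) ∣T─L∣≡1+j))

[1+n]C2≡n+nC2 : ∀ n → suc n C 2 ≡ n + n C 2
[1+n]C2≡n+nC2 n = trans (sym (nCk+nC[k+1]≡[n+1]C[k+1] n 1)) (cong (_+ n C 2) (nC1≡n n))

2*[nC2]+n≡n*n : ∀ n → 2 * (n C 2) + n ≡ n * n
2*[nC2]+n≡n*n zero    = refl
2*[nC2]+n≡n*n (suc n) = begin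
  2 * (suc n C 2) + suc n          ≡⟨ cong (λ c → 2 * c + suc n) ([1+n]C2≡n+nC2 n) ⟩
  2 * (n + n C 2) + suc n          ≡⟨ regroup n (n C 2) ⟩
  (2 * (n C 2) + n) + (2 * n + 1)  ≡⟨ cong (_+ (2 * n + 1)) (2*[nC2]+n≡n*n n) ⟩
  n * n + (2 * n + 1)              ≡⟨ square-suc n ⟩
  suc n * suc n                    ∎
  where
  open ≡-Reasoning
  regroup : ∀ n c → 2 * (n + c) + suc n ≡ (2 * c + n) + (2 * n + 1)
  regroup = solve-∀
  square-suc : ∀ n → n * n + (2 * n + 1) ≡ suc n * suc n
  square-suc = solve-∀

m+n≤o+p⇒m≤o∸n+p : ∀ {m n o p} → m + n ≤ o + p → m ≤ o ∸ n + p
m+n≤o+p⇒m≤o∸n+p {m} {n} {o} {p} m+n≤o+p = +-cancelʳ-≤ n m (o ∸ n + p)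
  (≤-trans m+n≤o+p (≤-trans (+-monoˡ-≤ p (m≤n+m∸n o n)) (≤-reflexive (rotate n (o ∸ n) p))))
  where
  rotate : ∀ n d p → n + d + p ≡ d + p + n
  rotate = solve-∀

-- Equality in fact holds; the inequality only avoids proving that the subtraction does not truncate.
binomial-estimate : ∀ k → (3 + k) C 3 + (2 + k + 1) ≤ (4 + k) C 3 ∸ k * (1 + k) + k C 2
binomial-estimate k = m+n≤o+p⇒m≤o∸n+p (≤-reflexive (begin
  X + (2 + k + 1) + k * (1 + k)                   ≡⟨ expand X k ⟩
  X + (2 + k) + 1 + k + k * k                     ≡⟨ cong (X + (2 + k) + 1 + k +_) (sym (2*[nC2]+n≡n*n k)) ⟩
  X + (2 + k) + 1 + k + (2 * s + k)               ≡⟨ regroup X k s ⟩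
  (2 + k) + ((1 + k) + (k + s)) + X + s           ≡⟨ cong (λ c → c + X + s) (sym [3+k]C2) ⟩
  (3 + k) C 2 + X + s                             ≡⟨ cong (_+ s) (nCk+nC[k+1]≡[n+1]C[k+1] (3 + k) 2) ⟩
  (4 + k) C 3 + s                                 ∎))
  where
  open ≡-Reasoning
  X s : ℕ
  X = (3 + k) C 3
  s = k C 2
  [3+k]C2 : (3 + k) C 2 ≡ (2 + k) + ((1 + k) + (k + s))
  [3+k]C2 = trans ([1+n]C2≡n+nC2 (2 + k))
    (cong (2 + k +_) (trans ([1+n]C2≡n+nC2 (1 + k)) (cong (1 + k +_) ([1+n]C2≡n+nC2 k))))
  expand : ∀ X k → X + (2 + k + 1) + k * (1 + k) ≡ X + (2 + k) + 1 + k + k * k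
  expand = solve-∀
  regroup : ∀ X k s → X + (2 + k) + 1 + k + (2 * s + k) ≡ (2 + k) + ((1 + k) + (k + s)) + X + s
  regroup = solve-∀

opposite-⁅⁆ : ∀ {n} {x a : Fin n} {B B′ : Subset n} →
  ∁ B′ ⊆ B → x ∉ₛ B′ → a ∉ₛ B → Opposite (⁅ x ⁆ , B) (⁅ a ⁆ , B′)
opposite-⁅⁆ {B = B} {B′} ∁B′⊆B x∉B′ a∉B =
  ⊆-antisym ⊆⊤ ⊤⊆B∪B′ , x∉p⇒⁅x⁆∩p≡⊥ x∉B′ , x∉p⇒⁅x⁆∩p≡⊥ a∉B
  where
  ⊤⊆B∪B′ : ⊤ ⊆ B ∪ B′
  ⊤⊆B∪B′ {i} _ with i ∈? B′
  ... | yes i∈B′ = x∈p∪q⁺ (inj₂ i∈B′)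
  ... | no i∉B′  = x∈p∪q⁺ (inj₁ (∁B′⊆B (x∉p⇒x∈∁p i∉B′)))

∣∁B∣≡3 : ∀ {k} {A B : Subset (3 + k)} → IsFlag (A , B) → ∣ ∁ B ∣ ≡ 3
∣∁B∣≡3 {k} {B = B} (_ , _ , ∣B∣≡k) =
  trans (∣∁p∣≡n∸∣p∣ B) (trans (cong (3 + k ∸_) ∣B∣≡k) (m+n∸n≡m 3 k))

module UncoveredPoint {k : ℕ} {F : List (Pair (3 + k))} (F-independent : IsIndependentSet F)
  {a : Fin (3 + k)} {B₁ B₂ : Subset (3 + k)} (f₁ : (⁅ a ⁆ , B₁) ∈ F) (f₂ : (⁅ a ⁆ , B₂) ∈ F)
  (∣D∣≡2 : ∣ ∁ (B₁ ∪ B₂) ∣ ≡ 2) {x : Fin (3 + k)} (x∈D : x ∈ₛ ∁ (B₁ ∪ B₂)) where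

  F-unique : Unique F
  F-unique = proj₁ F-independent

  F-flag : ∀ {f} → f ∈ F → IsFlag f
  F-flag = proj₁ (proj₂ F-independent)

  F-nonadjacent : ∀ {f g} → f ∈ F → g ∈ F → ¬ Opposite f g
  F-nonadjacent = proj₂ (proj₂ F-independent)

  D : Subset (3 + k)
  D = ∁ (B₁ ∪ B₂)

  ∈D⇒∉B₁ : ∀ {i} → i ∈ₛ D → i ∉ₛ B₁
  ∈D⇒∉B₁ i∈D = x∈∁p⇒x∉p i∈D ∘ x∈p∪q⁺ ∘ inj₁

  ∈D⇒∉B₂ : ∀ {i} → i ∈ₛ D → i ∉ₛ B₂
  ∈D⇒∉B₂ i∈D = x∈∁p⇒x∉p i∈D ∘ x∈p∪q⁺ ∘ inj₂

  a∈B₁ : a ∈ₛ B₁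
  a∈B₁ = proj₁ (F-flag f₁) (x∈⁅x⁆ a)

  a≢x : a ≢ x
  a≢x = ∈∧∉⇒≢ a∈B₁ (∈D⇒∉B₁ x∈D)

  D-x≡⁅y⁆ : ∃ λ y → D - x ≡ ⁅ y ⁆
  D-x≡⁅y⁆ = ∣p∣≡1⇒p≡⁅x⁆ (D - x) (x∈p⇒∣p-x∣≡pred∣p∣ x∈D ∣D∣≡2)

  y : Fin (3 + k)
  y = proj₁ D-x≡⁅y⁆

  y∈D-x : y ∈ₛ D - x
  y∈D-x = subst (y ∈ₛ_) (sym (proj₂ D-x≡⁅y⁆)) (x∈⁅x⁆ y)

  y∈D : y ∈ₛ D
  y∈D = p─q⊆p D ⁅ x ⁆ y∈D-x

  y≢x : y ≢ x
  y≢x = x∉⁅y⁆⇒x≢y (x∈p─q⇒x∉q D ⁅ x ⁆ y∈D-x)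

  y≢a : y ≢ a
  y≢a = ∈∧∉⇒≢ a∈B₁ (∈D⇒∉B₁ y∈D) ∘ sym

  ∈D⇒≡x⊎≡y : ∀ {i} → i ∈ₛ D → i ≡ x ⊎ i ≡ y
  ∈D⇒≡x⊎≡y i∈D with ∈⇒≡⊎∈- x i∈D
  ... | inj₁ i≡x   = inj₁ i≡x
  ... | inj₂ i∈D-x = inj₂ (x∈⁅y⁆⇒x≡y y (subst (_ ∈ₛ_) (proj₂ D-x≡⁅y⁆) i∈D-x))

  x∉∁B : ∀ {B} → (⁅ x ⁆ , B) ∈ F → x ∉ₛ ∁ B
  x∉∁B f = x∈p⇒x∉∁p (proj₁ (F-flag f) (x∈⁅x⁆ x))

  module ThirdPoint {B′ : Subset (3 + k)} (f′ : (⁅ a ⁆ , B′) ∈ F) (x∉B′ : x ∉ₛ B′) (y∉B′ : y ∉ₛ B′) where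

    ∁B′-x-y≡⁅z⁆ : ∃ λ z → ∁ B′ - x - y ≡ ⁅ z ⁆
    ∁B′-x-y≡⁅z⁆ = ∣p∣≡1⇒p≡⁅x⁆ (∁ B′ - x - y)
      (x∈p⇒∣p-x∣≡pred∣p∣ (x∈p∧x≢y⇒x∈p-y (x∉p⇒x∈∁p y∉B′) y≢x)
        (x∈p⇒∣p-x∣≡pred∣p∣ (x∉p⇒x∈∁p x∉B′) (∣∁B∣≡3 (F-flag f′))))

    z : Fin (3 + k)
    z = proj₁ ∁B′-x-y≡⁅z⁆

    z∈∁B′-x-y : z ∈ₛ ∁ B′ - x - y
    z∈∁B′-x-y = subst (z ∈ₛ_) (sym (proj₂ ∁B′-x-y≡⁅z⁆)) (x∈⁅x⁆ z)

    z∉B′ : z ∉ₛ B′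
    z∉B′ = x∈∁p⇒x∉p (p─q⊆p (∁ B′) ⁅ x ⁆ (p─q⊆p (∁ B′ - x) ⁅ y ⁆ z∈∁B′-x-y))

    z≢x : z ≢ x
    z≢x = x∉⁅y⁆⇒x≢y (x∈p─q⇒x∉q (∁ B′) ⁅ x ⁆ (p─q⊆p (∁ B′ - x) ⁅ y ⁆ z∈∁B′-x-y))

    z≢y : z ≢ y
    z≢y = x∉⁅y⁆⇒x≢y (x∈p─q⇒x∉q (∁ B′ - x) ⁅ y ⁆ z∈∁B′-x-y)

    z≢a : z ≢ a
    z≢a = ∈∧∉⇒≢ (proj₁ (F-flag f′) (x∈⁅x⁆ a)) z∉B′ ∘ sym

    ∁B′⊆B : ∀ {B} → x ∈ₛ B → y ∈ₛ B → z ∈ₛ B → ∁ B′ ⊆ B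
    ∁B′⊆B x∈B y∈B z∈B i∈∁B′ with ∈⇒≡⊎∈- x i∈∁B′
    ... | inj₁ refl = x∈B
    ... | inj₂ i∈∁B′-x with ∈⇒≡⊎∈- y i∈∁B′-x
    ...   | inj₁ refl = y∈B
    ...   | inj₂ i∈∁B′-x-y =
      subst (_∈ₛ _) (sym (x∈⁅y⁆⇒x≡y z (subst (_ ∈ₛ_) (proj₂ ∁B′-x-y≡⁅z⁆) i∈∁B′-x-y))) z∈B

    -- B would be opposite to B′ otherwise.
    z∈∁B : ∀ {B} → (⁅ x ⁆ , B) ∈ F → a ∈ₛ ∁ B → y ∉ₛ ∁ B → z ∈ₛ ∁ B
    z∈∁B {B} f a∈∁B y∉∁B with z ∈? ∁ B
    ... | yes z∈∁B = z∈∁B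
    ... | no z∉∁B  = ⊥-elim (F-nonadjacent f f′
      (opposite-⁅⁆ (∁B′⊆B (x∉∁p⇒x∈p (x∉∁B f)) (x∉∁p⇒x∈p y∉∁B) (x∉∁p⇒x∈p z∉∁B)) x∉B′ (x∈∁p⇒x∉p a∈∁B)))

  module Z₁ = ThirdPoint f₁ (∈D⇒∉B₁ x∈D) (∈D⇒∉B₁ y∈D)
  module Z₂ = ThirdPoint f₂ (∈D⇒∉B₂ x∈D) (∈D⇒∉B₂ y∈D)
  open Z₁ using () renaming (z to z₁)
  open Z₂ using () renaming (z to z₂)

  z₁∉D : z₁ ∉ₛ D
  z₁∉D z₁∈D with ∈D⇒≡x⊎≡y z₁∈D
  ... | inj₁ z₁≡x = Z₁.z≢x z₁≡x
  ... | inj₂ z₁≡y = Z₁.z≢y z₁≡y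

  z₁∈B₂ : z₁ ∈ₛ B₂
  z₁∈B₂ with x∈p∪q⁻ B₁ B₂ (x∉∁p⇒x∈p z₁∉D)
  ... | inj₁ z₁∈B₁ = ⊥-elim (Z₁.z∉B′ z₁∈B₁)
  ... | inj₂ z₁∈B₂ = z₁∈B₂

  z₂≢z₁ : z₂ ≢ z₁
  z₂≢z₁ = ∈∧∉⇒≢ z₁∈B₂ Z₂.z∉B′ ∘ sym

  ∁B⊆∁⁅x⁆ : ∀ {B} → (⁅ x ⁆ , B) ∈ F → ∁ B ⊆ ∁ ⁅ x ⁆
  ∁B⊆∁⁅x⁆ f i∈∁B = x∉p⇒x∈∁p (x≢y⇒x∉⁅y⁆ (∈∧∉⇒≢ i∈∁B (x∉∁B f)))

  avoiding-a : List (Subset (3 + k))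
  avoiding-a = between ⊥ (∁ ⁅ x ⁆ - a) 3

  through-a-y : List (Subset (3 + k))
  through-a-y = between (⁅ a ⁆ ∪ ⁅ y ⁆) (∁ ⁅ x ⁆) 1

  through-a-z₁-z₂ : List (Subset (3 + k))
  through-a-z₁-z₂ = between (⁅ a ⁆ ∪ ⁅ z₁ ⁆ ∪ ⁅ z₂ ⁆) ⊤ 0

  candidates : List (Subset (3 + k))
  candidates = avoiding-a ++ through-a-y ++ through-a-z₁-z₂

  ∁B∈avoiding-a : ∀ {B} → (⁅ x ⁆ , B) ∈ F → a ∉ₛ ∁ B → ∁ B ∈ avoiding-a
  ∁B∈avoiding-a {B} f a∉∁B =
    ∈-between ⊥⊆ (λ i∈∁B → x∈p∧x≢y⇒x∈p-y (∁B⊆∁⁅x⁆ f i∈∁B) (∈∧∉⇒≢ i∈∁B a∉∁B))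
      (trans (cong ∣_∣ (p─⊥≡p (∁ B))) (∣∁B∣≡3 (F-flag f)))

  ∁B∈through-a-y : ∀ {B} → (⁅ x ⁆ , B) ∈ F → a ∈ₛ ∁ B → y ∈ₛ ∁ B → ∁ B ∈ through-a-y
  ∁B∈through-a-y {B} f a∈∁B y∈∁B =
    ∈-between (p⊆r∧q⊆r⇒p∪q⊆r (x∈p⇒⁅x⁆⊆p a∈∁B) (x∈p⇒⁅x⁆⊆p y∈∁B)) (∁B⊆∁⁅x⁆ f) (begin
      ∣ ∁ B ─ (⁅ a ⁆ ∪ ⁅ y ⁆) ∣  ≡⟨ cong ∣_∣ (sym (p─q─r≡p─q∪r (∁ B) ⁅ a ⁆ ⁅ y ⁆)) ⟩
      ∣ ∁ B - a - y ∣            ≡⟨ x∈p⇒∣p-x∣≡pred∣p∣ (x∈p∧x≢y⇒x∈p-y y∈∁B y≢a)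
                                      (x∈p⇒∣p-x∣≡pred∣p∣ a∈∁B (∣∁B∣≡3 (F-flag f))) ⟩
      1                          ∎)
    where open ≡-Reasoning

  ∁B∈through-a-z₁-z₂ : ∀ {B} → (⁅ x ⁆ , B) ∈ F → a ∈ₛ ∁ B → y ∉ₛ ∁ B → ∁ B ∈ through-a-z₁-z₂
  ∁B∈through-a-z₁-z₂ {B} f a∈∁B y∉∁B =
    ∈-between (p⊆r∧q⊆r⇒p∪q⊆r (x∈p⇒⁅x⁆⊆p a∈∁B)
                (p⊆r∧q⊆r⇒p∪q⊆r (x∈p⇒⁅x⁆⊆p z₁∈∁B) (x∈p⇒⁅x⁆⊆p z₂∈∁B))) ⊆⊤ (begin
      ∣ ∁ B ─ (⁅ a ⁆ ∪ ⁅ z₁ ⁆ ∪ ⁅ z₂ ⁆) ∣  ≡⟨ cong ∣_∣ (sym (p─q─r≡p─q∪r (∁ B) ⁅ a ⁆ (⁅ z₁ ⁆ ∪ ⁅ z₂ ⁆))) ⟩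
      ∣ ∁ B - a ─ (⁅ z₁ ⁆ ∪ ⁅ z₂ ⁆) ∣      ≡⟨ cong ∣_∣ (sym (p─q─r≡p─q∪r (∁ B - a) ⁅ z₁ ⁆ ⁅ z₂ ⁆)) ⟩
      ∣ ∁ B - a - z₁ - z₂ ∣                ≡⟨ x∈p⇒∣p-x∣≡pred∣p∣ z₂∈∁B-a-z₁ (x∈p⇒∣p-x∣≡pred∣p∣ z₁∈∁B-a
                                                (x∈p⇒∣p-x∣≡pred∣p∣ a∈∁B (∣∁B∣≡3 (F-flag f)))) ⟩
      0                                    ∎)
    where
    open ≡-Reasoning
    z₁∈∁B : z₁ ∈ₛ ∁ B
    z₁∈∁B = Z₁.z∈∁B f a∈∁B y∉∁B
    z₂∈∁B : z₂ ∈ₛ ∁ B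
    z₂∈∁B = Z₂.z∈∁B f a∈∁B y∉∁B
    z₁∈∁B-a : z₁ ∈ₛ ∁ B - a
    z₁∈∁B-a = x∈p∧x≢y⇒x∈p-y z₁∈∁B Z₁.z≢a
    z₂∈∁B-a-z₁ : z₂ ∈ₛ ∁ B - a - z₁
    z₂∈∁B-a-z₁ = x∈p∧x≢y⇒x∈p-y (x∈p∧x≢y⇒x∈p-y z₂∈∁B Z₂.z≢a) z₂≢z₁

  ∁B∈candidates : ∀ {B} → (⁅ x ⁆ , B) ∈ F → ∁ B ∈ candidates
  ∁B∈candidates {B} f with a ∈? ∁ B | y ∈? ∁ B
  ... | no a∉∁B  | _        = ∈-++⁺ˡ (∁B∈avoiding-a f a∉∁B)
  ... | yes a∈∁B | yes y∈∁B = ∈-++⁺ʳ avoiding-a (∈-++⁺ˡ (∁B∈through-a-y f a∈∁B y∈∁B))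
  ... | yes a∈∁B | no y∉∁B  = ∈-++⁺ʳ avoiding-a (∈-++⁺ʳ through-a-y (∁B∈through-a-z₁-z₂ f a∈∁B y∉∁B))

  at-x? : (f : Pair (3 + k)) → Dec (proj₁ f ≡ ⁅ x ⁆)
  at-x? f = proj₁ f ≟ˢ ⁅ x ⁆

  flags-at-x : List (Pair (3 + k))
  flags-at-x = filter at-x? F

  complements : List (Subset (3 + k))
  complements = map (∁ ∘ proj₂) flags-at-x

  complements-unique : Unique complements
  complements-unique = Unique-map⁺ (∁ ∘ proj₂) injective (filter⁺ at-x? F-unique)
    where
    injective : ∀ {u v} → u ∈ flags-at-x → v ∈ flags-at-x → ∁ (proj₂ u) ≡ ∁ (proj₂ v) → u ≡ v
    injective u∈ v∈ ∁B≡∁B′ =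
      cong₂ _,_ (trans (proj₂ (∈-filter⁻ at-x? {xs = F} u∈))
                       (sym (proj₂ (∈-filter⁻ at-x? {xs = F} v∈))))
                (∁-injective ∁B≡∁B′)

  complements⊆candidates : ∀ {T} → T ∈ complements → T ∈ candidates
  complements⊆candidates T∈ with ∈-map⁻ (∁ ∘ proj₂) T∈
  ... | (_ , B) , f∈flags-at-x , refl with ∈-filter⁻ at-x? {xs = F} f∈flags-at-x
  ... | f∈F , refl = ∁B∈candidates f∈F

  ∣∁⁅x⁆-a∣≡1+k : ∣ ∁ ⁅ x ⁆ - a ∣ ≡ 1 + k
  ∣∁⁅x⁆-a∣≡1+k = x∈p⇒∣p-x∣≡pred∣p∣ (x∉p⇒x∈∁p (x≢y⇒x∉⁅y⁆ a≢x))
    (trans (∣∁p∣≡n∸∣p∣ ⁅ x ⁆) (cong (3 + k ∸_) (∣⁅x⁆∣≡1 x)))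

  ∣∁⁅x⁆-a-y∣≡k : ∣ ∁ ⁅ x ⁆ - a - y ∣ ≡ k
  ∣∁⁅x⁆-a-y∣≡k = x∈p⇒∣p-x∣≡pred∣p∣ (x∈p∧x≢y⇒x∈p-y (x∉p⇒x∈∁p (x≢y⇒x∉⁅y⁆ y≢x)) y≢a) ∣∁⁅x⁆-a∣≡1+k

  length-candidates : length candidates ≡ (1 + k) C 3 + (k + 1)
  length-candidates = begin
    length (avoiding-a ++ through-a-y ++ through-a-z₁-z₂)
      ≡⟨ length-++ avoiding-a ⟩
    length avoiding-a + length (through-a-y ++ through-a-z₁-z₂)
      ≡⟨ cong (length avoiding-a +_) (length-++ through-a-y) ⟩
    length avoiding-a + (length through-a-y + length through-a-z₁-z₂)
      ≡⟨ cong₂ (λ u v → u + (v + length through-a-z₁-z₂))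
               (length-between ⊥ (∁ ⁅ x ⁆ - a) 3) (length-between (⁅ a ⁆ ∪ ⁅ y ⁆) (∁ ⁅ x ⁆) 1) ⟩
    ∣ ∁ ⁅ x ⁆ - a ─ ⊥ ∣ C 3 + (∣ ∁ ⁅ x ⁆ ─ (⁅ a ⁆ ∪ ⁅ y ⁆) ∣ C 1 + length through-a-z₁-z₂)
      ≡⟨ cong₂ (λ u v → u C 3 + (v + length through-a-z₁-z₂))
               (trans (cong ∣_∣ (p─⊥≡p (∁ ⁅ x ⁆ - a))) ∣∁⁅x⁆-a∣≡1+k)
               (trans (nC1≡n _) (trans (cong ∣_∣ (sym (p─q─r≡p─q∪r (∁ ⁅ x ⁆) ⁅ a ⁆ ⁅ y ⁆))) ∣∁⁅x⁆-a-y∣≡k)) ⟩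
    (1 + k) C 3 + (k + length through-a-z₁-z₂)
      ≡⟨ cong (λ u → (1 + k) C 3 + (k + u)) (length-between (⁅ a ⁆ ∪ ⁅ z₁ ⁆ ∪ ⁅ z₂ ⁆) ⊤ 0) ⟩
    (1 + k) C 3 + (k + 1)
      ∎
    where open ≡-Reasoning

  weight-bound : weight F ⁅ x ⁆ ≤ (1 + k) C 3 + (k + 1)
  weight-bound = begin
    weight F ⁅ x ⁆       ≡⟨ length-map (∁ ∘ proj₂) flags-at-x ⟨
    length complements   ≤⟨ Unique∧⊆⇒length≤ complements-unique complements⊆candidates ⟩
    length candidates    ≡⟨ length-candidates ⟩
    (1 + k) C 3 + (k + 1) ∎
    where open ≤-Reasoning

lemma5p1 : (n : ℕ) → 7 ≤ n → (F : List (Pair n)) → IsIndependentSet F →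
    (A₁ B₁ A₂ B₂ : Subset n) → (A₁ , B₁) ∈ F → (A₂ , B₂) ∈ F →
    A₁ ≡ A₂ → B₁ ≢ B₂ → ∣ ∁ (B₁ ∪ B₂) ∣ ≡ 2 →
    (A : Subset n) → A ⊆ ∁ (B₁ ∪ B₂) → ∣ A ∣ ≡ 1 →
    weight F A ≤ ((n ∸ 1) C 3 ∸ (n ∸ 5) * (n ∸ 4)) + (n ∸ 5) C 2
lemma5p1 n 7≤n F F-independent A₁ B₁ .A₁ B₂ f₁ f₂ refl _ ∣D∣≡2 A A⊆D ∣A∣≡1
  with m≤n⇒∃[o]m+o≡n 7≤n | ∣p∣≡1⇒p≡⁅x⁆ A ∣A∣≡1 | ∣p∣≡1⇒p≡⁅x⁆ A₁ (proj₁ (proj₂ (proj₁ (proj₂ F-independent) f₁)))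
... | m , refl | x , refl | a , refl =
  ≤-trans (UncoveredPoint.weight-bound F-independent f₁ f₂ ∣D∣≡2 (A⊆D (x∈⁅x⁆ x))) (binomial-estimate (2 + m))
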